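{- Let $M=(S,\mathcal{I})$ be a matroid, $S_0\subseteq S$ a set such that some basis of $M$ is not contained in $S_0$, and $w\in\mathbb{Z}^S$. Assume that $M$ has a maximum $w$-weight basis contained in $S_0$ and also a maximum $w$-weight basis not contained in $S_0$. Then $w^*=w-\chi_{S_0}+\chi_{S\setminus S_0}$ is an optimal solution of the IM-Not-Exists instance $(M,S_0,w,\|\cdot\|_\infty)$.
   Context: IM-Not-Exists: given $M$, $S_0$ (not containing some basis) and $w\in\mathbb{Z}^S$, find $w^*\in\mathbb{Z}^S$ such that no basis contained in $S_0$ is a maximum $w^*$-weight basis of $M$, minimizing $\|w-w^*\|_\infty=\max_s|w(s)-w^*(s)|$. $\chi_Z$ is the characteristic vector of $Z$. -}

module Defs where

open import Data.Nat using (ℕ; _⊔_) renaming (_≤_ to _≤ℕ_)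
open import Data.Integer using (ℤ; _+_; _-_; ∣_∣; _≤_; 0ℤ; 1ℤ)
open import Data.Fin using (Fin)
open import Data.Fin.Subset using (Subset; _∈_; _⊆_; ⊥; _⊂_)
open import Data.Fin.Subset.Properties using (_∈?_)
open import Data.List using (List; foldr; allFin)
open import Data.Product using (Σ; _×_; _,_)
open import Relation.Nullary using (¬_; yes; no)
open import Level using (Level; suc; _⊔_) renaming (zero to lzero)

record Matroid (n : ℕ) : Set₁ where
  field
    Indep : Subset n → Set
    indep-∅ : Indep ⊥
    indep-⊆ : ∀ {X Y} → X ⊆ Y → Indep Y → Indep X
    indep-aug : ∀ {X Y} → Indep X → Indep Y →
      Data.Fin.Subset.∣ X ∣ Data.Nat.< Data.Fin.Subset.∣ Y ∣ →
      Σ (Fin n) λ e → (e ∈ Y) × (¬ (e ∈ X)) × Indep (Data.Fin.Subset._∪_ X (Data.Fin.Subset.⁅_⁆ e))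

open Matroid public

IsBasis : ∀ {n} → Matroid n → Subset n → Set
IsBasis M B = Indep M B × (∀ Y → B ⊂ Y → ¬ Indep M Y)

Weight : ℕ → Set
Weight n = Fin n → ℤ

weightOf : ∀ {n} → Weight n → Subset n → ℤ
weightOf {n} w B = foldr (λ i acc → step i Data.Integer.+ acc) 0ℤ (allFin n)
  where
  step : Fin n → ℤ
  step i with i ∈? B
  ... | yes _ = w i
  ... | no  _ = 0ℤ

IsMaxWeightBasis : ∀ {n} → Matroid n → Weight n → Subset n → Set
IsMaxWeightBasis M w B = IsBasis M B × (∀ B' → IsBasis M B' → weightOf w B' ≤ weightOf w B)

χ : ∀ {n} → Subset n → Weight n
χ Z i with i ∈? Z
... | yes _ = 1ℤ
... | no  _ = 0ℤ

compl : ∀ {n} → Subset n → Subset n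
compl = Data.Fin.Subset.∁

-- ‖w - w'‖_∞ = max_s |w(s) - w'(s)|   (0 for the empty ground set)
distInf : ∀ {n} → Weight n → Weight n → ℕ
distInf {n} w w' = foldr (λ i acc → ∣ w i - w' i ∣ Data.Nat.⊔ acc) 0 (allFin n)

NotExistsFeasible : ∀ {n} → Matroid n → Subset n → Weight n → Set
NotExistsFeasible M S₀ w* = ∀ B → B ⊆ S₀ → ¬ IsMaxWeightBasis M w* B

IsOptimalNotExists : ∀ {n} → Matroid n → Subset n → Weight n → Weight n → Set
IsOptimalNotExists M S₀ w w* =
  NotExistsFeasible M S₀ w* ×
  (∀ w' → NotExistsFeasible M S₀ w' → distInf w w* ≤ℕ distInf w w')

-- The tilt w* = w − χ_{S₀} + χ_{S∖S₀} lowers the weight of every basis B by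
-- ∣B∣ and then adds 2∣B ∖ S₀∣. Bases have a common size, so a basis inside S₀
-- loses exactly ∣B∣ while a maximum w-weight basis leaving S₀ gains at least
-- 2 on top of that: no basis inside S₀ stays maximal, and w* is feasible at
-- ∞-distance 1. Distance 0 is impossible, since w itself has a maximum
-- weight basis inside S₀.
module Submission where

open import Defs
open import Data.Nat using (ℕ)
open import Data.Integer using (_+_; _-_)
open import Data.Fin.Subset using (Subset; _⊆_)
open import Data.Product using (Σ; _×_)
open import Relation.Nullary using (¬_)

open import Data.Nat as ℕ using (zero; suc; z≤n; s≤s)
import Data.Nat.Properties as ℕP
open import Data.Integer as ℤ using (ℤ; 0ℤ; 1ℤ; +_; _*_; ∣_∣; _≤_; _<_)
import Data.Integer.Properties as ℤP
open import Data.Integer.Tactic.RingSolver using (solve-∀)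
open import Data.Fin using (Fin)
open import Data.Fin.Properties using (¬∀⟶∃¬)
open import Data.Fin.Subset using (_∈_; _∉_; _∪_; ⁅_⁆; ∁; inside; outside) renaming (∣_∣ to ∣_∣ˢ)
open import Data.Fin.Subset.Properties using (_∈?_; x∈∁p⇒x∉p; x∉p⇒x∈∁p; x∈p⇒x∉∁p; p⊆p∪q; x∈p∪q⁺; x∈⁅x⁆)
open import Data.Vec using (_∷_; [])
open import Data.Vec.Functional using (removeAt)
open import Data.List using (List; allFin; tabulate)
import Data.List as List
open import Data.List.Membership.Propositional using () renaming (_∈_ to _∈ˡ_)
open import Data.List.Membership.Propositional.Properties using (∈-allFin)
open import Data.List.Relation.Unary.Any using (here; there)
open import Data.Product using (∃; _,_; proj₁; proj₂)
open import Data.Sum using (inj₂)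
open import Data.Empty using (⊥-elim)
open import Function using (id; _∘_)
open import Relation.Nullary using (yes; no; contradiction)
open import Relation.Nullary.Decidable using (_→-dec_)
open import Relation.Binary.PropositionalEquality using (_≡_; refl; sym; trans; cong; cong₂; subst₂; module ≡-Reasoning)
open import Algebra.Properties.CommutativeMonoid.Sum ℤP.+-0-commutativeMonoid
  using (sum; sum-syntax; sum-cong-≗; ∑-distrib-+; sum-remove; sum-replicate-zero)

private
  variable
    n : ℕ

χ-∈ : ∀ {Z : Subset n} {s} → s ∈ Z → χ Z s ≡ 1ℤ
χ-∈ {Z = Z} {s} s∈Z with s ∈? Z
... | yes _   = refl
... | no s∉Z = contradiction s∈Z s∉Z

χ-∉ : ∀ {Z : Subset n} {s} → s ∉ Z → χ Z s ≡ 0ℤ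
χ-∉ {Z = Z} {s} s∉Z with s ∈? Z
... | yes s∈Z = contradiction s∈Z s∉Z
... | no _    = refl

χ-+-χ-∁ : ∀ (Z : Subset n) s → χ Z s + χ (∁ Z) s ≡ 1ℤ
χ-+-χ-∁ Z s with s ∈? Z | s ∈? ∁ Z
... | yes s∈Z | yes s∈∁Z = contradiction s∈Z (x∈∁p⇒x∉p s∈∁Z)
... | yes _   | no _     = refl
... | no _    | yes _    = refl
... | no s∉Z  | no s∉∁Z = contradiction (x∉p⇒x∈∁p s∉Z) s∉∁Z

∣χ-χ∣≤1 : ∀ (X Y : Subset n) s → ∣ χ X s - χ Y s ∣ ℕ.≤ 1
∣χ-χ∣≤1 X Y s with s ∈? X | s ∈? Y
... | yes _ | yes _ = z≤n
... | yes _ | no _  = s≤s z≤n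
... | no _  | yes _ = s≤s z≤n
... | no _  | no _  = z≤n

χ-nonneg : ∀ (Z : Subset n) s → 0ℤ ≤ χ Z s
χ-nonneg Z s with s ∈? Z
... | yes _ = ℤ.+≤+ z≤n
... | no _  = ℤ.+≤+ z≤n

χ-∷-suc : ∀ x (Z : Subset n) s → χ (x ∷ Z) (Fin.suc s) ≡ χ Z s
χ-∷-suc x Z s with s ∈? Z
... | yes _ = refl
... | no _  = refl

∑-χ : ∀ (Z : Subset n) → ∑[ s < n ] χ Z s ≡ + ∣ Z ∣ˢ
∑-χ []            = refl
∑-χ (inside ∷ Z)  = cong (_+_ 1ℤ) (trans (sum-cong-≗ (χ-∷-suc inside Z)) (∑-χ Z))
∑-χ (outside ∷ Z) = cong (_+_ 0ℤ) (trans (sum-cong-≗ (χ-∷-suc outside Z)) (∑-χ Z))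

∑-nonneg : ∀ (f : Fin n → ℤ) → (∀ i → 0ℤ ≤ f i) → 0ℤ ≤ ∑[ i < n ] f i
∑-nonneg {zero}  f f≥0 = ℤP.≤-refl
∑-nonneg {suc n} f f≥0 = ℤP.+-mono-≤ (f≥0 Fin.zero) (∑-nonneg (f ∘ Fin.suc) (f≥0 ∘ Fin.suc))

term≤∑ : ∀ (f : Fin n → ℤ) → (∀ i → 0ℤ ≤ f i) → ∀ i → f i ≤ ∑[ j < n ] f j
term≤∑ {suc n} f f≥0 i = begin
  f i                      ≡⟨ ℤP.+-identityʳ (f i) ⟨
  f i + 0ℤ                 ≤⟨ ℤP.+-monoʳ-≤ (f i) (∑-nonneg (removeAt f i) (f≥0 ∘ _)) ⟩
  f i + sum (removeAt f i) ≡⟨ sum-remove f ⟨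
  sum f                    ∎
  where open ℤP.≤-Reasoning

private
  -- `weightOf` folds a step function local to its definition; unification
  -- names that function for us.
  weightOf-step : ∀ (w : Weight n) B →
    Σ (Fin n → ℤ → ℤ) λ f → weightOf w B ≡ List.foldr f 0ℤ (allFin n)
  weightOf-step w B = _ , refl

  weightOf-step-χ : ∀ (w : Weight n) B i acc →
    proj₁ (weightOf-step w B) i acc ≡ χ B i * w i + acc
  weightOf-step-χ w B i acc with i ∈? B
  ... | yes _ = cong (_+ acc) (sym (ℤP.*-identityˡ (w i)))
  ... | no _  = refl

foldr-tabulate : ∀ {m} {A : Set} (f : A → ℤ → ℤ) (h : A → ℤ) (g : Fin m → A) →
  (∀ x acc → f x acc ≡ h x + acc) → List.foldr f 0ℤ (tabulate g) ≡ ∑[ i < m ] h (g i)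
foldr-tabulate {zero}  f h g f≡h+ = refl
foldr-tabulate {suc m} f h g f≡h+ =
  trans (f≡h+ (g Fin.zero) _) (cong (_+_ (h (g Fin.zero))) (foldr-tabulate f h (g ∘ Fin.suc) f≡h+))

weightOf-∑ : ∀ (w : Weight n) B → weightOf w B ≡ ∑[ i < n ] (χ B i * w i)
weightOf-∑ w B = trans (proj₂ (weightOf-step w B)) (foldr-tabulate _ _ id (weightOf-step-χ w B))

weightOf-+ : ∀ (u v : Weight n) B → weightOf (λ s → u s + v s) B ≡ weightOf u B + weightOf v B
weightOf-+ {n} u v B = begin
  weightOf (λ s → u s + v s) B                        ≡⟨ weightOf-∑ _ B ⟩
  ∑[ i < n ] (χ B i * (u i + v i))                    ≡⟨ sum-cong-≗ (λ i → ℤP.*-distribˡ-+ (χ B i) (u i) (v i)) ⟩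
  ∑[ i < n ] (χ B i * u i + χ B i * v i)              ≡⟨ ∑-distrib-+ (λ i → χ B i * u i) (λ i → χ B i * v i) ⟩
  ∑[ i < n ] (χ B i * u i) + ∑[ i < n ] (χ B i * v i) ≡⟨ cong₂ _+_ (weightOf-∑ u B) (weightOf-∑ v B) ⟨
  weightOf u B + weightOf v B                         ∎
  where open ≡-Reasoning

weightOf-cong-∈ : ∀ {u v : Weight n} B → (∀ {s} → s ∈ B → u s ≡ v s) → weightOf u B ≡ weightOf v B
weightOf-cong-∈ {u = u} {v} B u≡v = begin
  weightOf u B             ≡⟨ weightOf-∑ u B ⟩
  ∑[ i < _ ] (χ B i * u i) ≡⟨ sum-cong-≗ χ*u≡χ*v ⟩
  ∑[ i < _ ] (χ B i * v i) ≡⟨ weightOf-∑ v B ⟨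
  weightOf v B             ∎
  where
  open ≡-Reasoning
  χ*u≡χ*v : ∀ i → χ B i * u i ≡ χ B i * v i
  χ*u≡χ*v i with i ∈? B
  ... | yes i∈B = cong (1ℤ *_) (u≡v i∈B)
  ... | no _    = refl

weightOf-0 : ∀ (B : Subset n) → weightOf (λ _ → 0ℤ) B ≡ 0ℤ
weightOf-0 {n} B = begin
  weightOf (λ _ → 0ℤ) B     ≡⟨ weightOf-∑ _ B ⟩
  ∑[ i < n ] (χ B i * 0ℤ)   ≡⟨ sum-cong-≗ (ℤP.*-zeroʳ ∘ χ B) ⟩
  ∑[ i < n ] 0ℤ             ≡⟨ sum-replicate-zero n ⟩
  0ℤ                        ∎
  where open ≡-Reasoning

weightOf-1 : ∀ (B : Subset n) → weightOf (λ _ → 1ℤ) B ≡ + ∣ B ∣ˢ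
weightOf-1 {n} B = begin
  weightOf (λ _ → 1ℤ) B    ≡⟨ weightOf-∑ _ B ⟩
  ∑[ i < n ] (χ B i * 1ℤ)  ≡⟨ sum-cong-≗ (ℤP.*-identityʳ ∘ χ B) ⟩
  ∑[ i < n ] χ B i         ≡⟨ ∑-χ B ⟩
  + ∣ B ∣ˢ                  ∎
  where open ≡-Reasoning

weightOf-≥-∈ : ∀ {u : Weight n} B → (∀ s → 0ℤ ≤ u s) → ∀ {s} → s ∈ B → u s ≤ weightOf u B
weightOf-≥-∈ {u = u} B u≥0 {s} s∈B = begin
  u s                      ≡⟨ ℤP.*-identityˡ (u s) ⟨
  1ℤ * u s                 ≡⟨ cong (_* u s) (χ-∈ s∈B) ⟨
  χ B s * u s              ≤⟨ term≤∑ (λ i → χ B i * u i) χ*u≥0 s ⟩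
  ∑[ i < _ ] (χ B i * u i) ≡⟨ weightOf-∑ u B ⟨
  weightOf u B             ∎
  where
  open ℤP.≤-Reasoning
  χ*u≥0 : ∀ i → 0ℤ ≤ χ B i * u i
  χ*u≥0 i with i ∈? B
  ... | yes _ = ℤP.≤-trans (u≥0 i) (ℤP.≤-reflexive (sym (ℤP.*-identityˡ (u i))))
  ... | no _  = ℤP.≤-refl

weightOf-χ-+-χ-∁ : ∀ (Z B : Subset n) → weightOf (χ Z) B + weightOf (χ (∁ Z)) B ≡ + ∣ B ∣ˢ
weightOf-χ-+-χ-∁ Z B = begin
  weightOf (χ Z) B + weightOf (χ (∁ Z)) B    ≡⟨ weightOf-+ (χ Z) (χ (∁ Z)) B ⟨
  weightOf (λ s → χ Z s + χ (∁ Z) s) B       ≡⟨ weightOf-cong-∈ B (λ {s} _ → χ-+-χ-∁ Z s) ⟩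
  weightOf (λ _ → 1ℤ) B                      ≡⟨ weightOf-1 B ⟩
  + ∣ B ∣ˢ                                    ∎
  where open ≡-Reasoning

⊈⇒∃∈∉ : ∀ {p q : Subset n} → ¬ (p ⊆ q) → ∃ λ x → x ∈ p × x ∉ q
⊈⇒∃∈∉ {n} {p} {q} p⊈q
  with ¬∀⟶∃¬ n (λ x → x ∈ p → x ∈ q) (λ x → (x ∈? p) →-dec (x ∈? q)) (λ p⊆q → p⊈q (p⊆q _))
... | x , ¬[x∈p→x∈q] with x ∈? p
...   | yes x∈p = x , x∈p , λ x∈q → ¬[x∈p→x∈q] (λ _ → x∈q)
...   | no x∉p  = ⊥-elim (¬[x∈p→x∈q] (λ x∈p → contradiction x∈p x∉p))

basis-card-≮ : ∀ (M : Matroid n) {B B′} → IsBasis M B → IsBasis M B′ → ¬ (∣ B ∣ˢ ℕ.< ∣ B′ ∣ˢ)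
basis-card-≮ M {B} (indepB , maximal) (indepB′ , _) ∣B∣<∣B′∣
  with indep-aug M indepB indepB′ ∣B∣<∣B′∣
... | e , _ , e∉B , indepB∪e =
  maximal (B ∪ ⁅ e ⁆) (p⊆p∪q ⁅ e ⁆ , e , x∈p∪q⁺ (inj₂ (x∈⁅x⁆ e)) , e∉B) indepB∪e

basis-card : ∀ (M : Matroid n) {B B′} → IsBasis M B → IsBasis M B′ → ∣ B ∣ˢ ≡ ∣ B′ ∣ˢ
basis-card M basis basis′ =
  ℕP.≤-antisym (ℕP.≮⇒≥ (basis-card-≮ M basis′ basis)) (ℕP.≮⇒≥ (basis-card-≮ M basis basis′))

isMaxWeightBasis-cong : ∀ (M : Matroid n) {w w′ B} → (∀ s → w s ≡ w′ s) →
  IsMaxWeightBasis M w B → IsMaxWeightBasis M w′ B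
isMaxWeightBasis-cong M {w} {w′} {B} w≡w′ (basis , maximum) = basis , λ B′ basis′ →
  subst₂ _≤_ (weightOf-cong-∈ B′ (λ {s} _ → w≡w′ s)) (weightOf-cong-∈ B (λ {s} _ → w≡w′ s))
    (maximum B′ basis′)

foldr-⊔-lub : ∀ {A : Set} (f : A → ℕ) (xs : List A) {k} → (∀ x → f x ℕ.≤ k) →
  List.foldr (λ x acc → f x ℕ.⊔ acc) 0 xs ℕ.≤ k
foldr-⊔-lub f List.[]        f≤k = z≤n
foldr-⊔-lub f (x List.∷ xs) f≤k = ℕP.⊔-lub (f≤k x) (foldr-⊔-lub f xs f≤k)

foldr-⊔-upper : ∀ {A : Set} (f : A → ℕ) {xs : List A} {x} → x ∈ˡ xs →
  f x ℕ.≤ List.foldr (λ y acc → f y ℕ.⊔ acc) 0 xs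
foldr-⊔-upper f {y List.∷ xs} (here refl) = ℕP.m≤m⊔n (f y) _
foldr-⊔-upper f {y List.∷ xs} (there x∈xs) = ℕP.≤-trans (foldr-⊔-upper f x∈xs) (ℕP.m≤n⊔m (f y) _)

distInf-lub : ∀ (w w′ : Weight n) {k} → (∀ s → ∣ w s - w′ s ∣ ℕ.≤ k) → distInf w w′ ℕ.≤ k
distInf-lub {n} w w′ = foldr-⊔-lub (λ s → ∣ w s - w′ s ∣) (allFin n)

distInf≡0⇒≡ : ∀ (w w′ : Weight n) → distInf w w′ ≡ 0 → ∀ s → w s ≡ w′ s
distInf≡0⇒≡ w w′ d≡0 s = ℤP.i-j≡0⇒i≡j (w s) (w′ s) (ℤP.∣i∣≡0⇒i≡0 (ℕP.n≤0⇒n≡0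
  (ℕP.≤-trans (foldr-⊔-upper (λ t → ∣ w t - w′ t ∣) (∈-allFin s)) (ℕP.≤-reflexive d≡0))))

tilt : Subset n → Weight n → Weight n
tilt S₀ w s = (w s - χ S₀ s) + χ (compl S₀) s

weightOf-tilt : ∀ (S₀ : Subset n) w B →
  weightOf (tilt S₀ w) B + + ∣ B ∣ˢ
    ≡ weightOf w B + (weightOf (χ (∁ S₀)) B + weightOf (χ (∁ S₀)) B)
weightOf-tilt S₀ w B = begin
  w* B + + ∣ B ∣ˢ                                     ≡⟨ cong (_+_ (w* B)) (weightOf-χ-+-χ-∁ S₀ B) ⟨
  w* B + (weightOf (χ S₀) B + c)                     ≡⟨ ℤP.+-assoc (w* B) _ c ⟨
  w* B + weightOf (χ S₀) B + c                       ≡⟨ cong (_+ c) (weightOf-+ (tilt S₀ w) (χ S₀) B) ⟨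
  weightOf (λ s → tilt S₀ w s + χ S₀ s) B + c        ≡⟨ cong (_+ c) (weightOf-cong-∈ B (λ {s} _ → untilt (w s) (χ S₀ s) (χ (∁ S₀) s))) ⟩
  weightOf (λ s → w s + χ (∁ S₀) s) B + c            ≡⟨ cong (_+ c) (weightOf-+ w (χ (∁ S₀)) B) ⟩
  weightOf w B + c + c                               ≡⟨ ℤP.+-assoc (weightOf w B) c c ⟩
  weightOf w B + (c + c)                             ∎
  where
  open ≡-Reasoning
  w* : Subset _ → ℤ
  w* = weightOf (tilt S₀ w)
  c : ℤ
  c = weightOf (χ (∁ S₀)) B
  untilt : ∀ x a b → ((x - a) + b) + a ≡ x + b
  untilt = solve-∀

distInf-tilt : ∀ (S₀ : Subset n) w → distInf w (tilt S₀ w) ℕ.≤ 1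
distInf-tilt S₀ w = distInf-lub w (tilt S₀ w) λ s →
  ℕP.≤-trans (ℕP.≤-reflexive (cong ∣_∣ (shift (w s) (χ S₀ s) (χ (∁ S₀) s)))) (∣χ-χ∣≤1 S₀ (∁ S₀) s)
  where
  shift : ∀ x a b → x - ((x - a) + b) ≡ a - b
  shift = solve-∀

tilt-feasible : ∀ (M : Matroid n) S₀ w →
  Σ (Subset n) (λ B → IsMaxWeightBasis M w B × ¬ (B ⊆ S₀)) →
  NotExistsFeasible M S₀ (tilt S₀ w)
tilt-feasible M S₀ w (B₂ , (basis₂ , maximum₂) , B₂⊈S₀) B B⊆S₀ (basis , maximum) =
  ℤP.≤⇒≯ (ℤP.+-monoˡ-≤ (+ ∣ B ∣ˢ) (maximum B₂ basis₂)) tilt-separates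
  where
  open ℤP.≤-Reasoning
  c₂ : ℤ
  c₂ = weightOf (χ (∁ S₀)) B₂
  c₂-pos : 0ℤ < c₂
  c₂-pos with ⊈⇒∃∈∉ B₂⊈S₀
  ... | s , s∈B₂ , s∉S₀ = ℤP.<-≤-trans (ℤ.+<+ (s≤s z≤n))
    (ℤP.≤-trans (ℤP.≤-reflexive (sym (χ-∈ (x∉p⇒x∈∁p s∉S₀)))) (weightOf-≥-∈ B₂ (χ-nonneg (∁ S₀)) s∈B₂))
  c-zero : weightOf (χ (∁ S₀)) B ≡ 0ℤ
  c-zero = trans (weightOf-cong-∈ B (λ s∈B → χ-∉ (x∈p⇒x∉∁p (B⊆S₀ s∈B)))) (weightOf-0 B)
  tilt-separates : weightOf (tilt S₀ w) B + + ∣ B ∣ˢ < weightOf (tilt S₀ w) B₂ + + ∣ B ∣ˢ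
  tilt-separates = begin-strict
    weightOf (tilt S₀ w) B + + ∣ B ∣ˢ   ≡⟨ weightOf-tilt S₀ w B ⟩
    weightOf w B + (weightOf (χ (∁ S₀)) B + weightOf (χ (∁ S₀)) B)
                                        ≡⟨ cong (λ c → weightOf w B + (c + c)) c-zero ⟩
    weightOf w B + 0ℤ                   ≡⟨ ℤP.+-identityʳ (weightOf w B) ⟩
    weightOf w B                        ≤⟨ maximum₂ B basis ⟩
    weightOf w B₂                       ≡⟨ ℤP.+-identityʳ (weightOf w B₂) ⟨
    weightOf w B₂ + 0ℤ                  <⟨ ℤP.+-monoʳ-< (weightOf w B₂) (ℤP.+-mono-<-≤ c₂-pos (ℤP.<⇒≤ c₂-pos)) ⟩
    weightOf w B₂ + (c₂ + c₂)           ≡⟨ weightOf-tilt S₀ w B₂ ⟨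
    weightOf (tilt S₀ w) B₂ + + ∣ B₂ ∣ˢ ≡⟨ cong (λ k → weightOf (tilt S₀ w) B₂ + + k) (basis-card M basis₂ basis) ⟩
    weightOf (tilt S₀ w) B₂ + + ∣ B ∣ˢ  ∎

feasible-distInf≥1 : ∀ (M : Matroid n) S₀ w →
  Σ (Subset n) (λ B → IsMaxWeightBasis M w B × B ⊆ S₀) →
  ∀ w′ → NotExistsFeasible M S₀ w′ → 1 ℕ.≤ distInf w w′
feasible-distInf≥1 M S₀ w (B₁ , maximum₁ , B₁⊆S₀) w′ feasible = ℕP.n≢0⇒n>0 λ d≡0 →
  feasible B₁ B₁⊆S₀ (isMaxWeightBasis-cong M (distInf≡0⇒≡ w w′ d≡0) maximum₁)

lemma6p1 : ∀ {n} (M : Matroid n) (S₀ : Subset n) (w : Weight n) →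
    Σ (Subset n) (λ B → IsBasis M B × ¬ (B ⊆ S₀)) →
    Σ (Subset n) (λ B → IsMaxWeightBasis M w B × B ⊆ S₀) →
    Σ (Subset n) (λ B → IsMaxWeightBasis M w B × ¬ (B ⊆ S₀)) →
    IsOptimalNotExists M S₀ w (λ s → (w s - χ S₀ s) + χ (compl S₀) s)
lemma6p1 M S₀ w _ maxInside maxOutside =
  tilt-feasible M S₀ w maxOutside ,
  λ w′ feasible → ℕP.≤-trans (distInf-tilt S₀ w) (feasible-distInf≥1 M S₀ w maxInside w′ feasible)
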